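{- Let $D=(A,U)$ and $D'=(A,U')$ be decision problems on the same product state space $S=X_1\times\cdots\times X_n$ with $|U(a,s)-U'(a,s)|\le\delta$ for all $a\in A$, $s\in S$. (a) Suppose states $s,s'$ agree on all coordinates $j\neq i$, their optimizer sets in $D$ are distinct singletons $\{a\},\{a'\}$, and at each of $s$ and $s'$ the unique optimizer $a^\star$ satisfies $U(a^\star,t)-U(b,t)\ge\gamma_t$ for all $b\neq a^\star$ with some $\gamma_t>2\delta$ ($t\in\{s,s'\}$). Then $i$ is relevant in $D'$. (b) Suppose states $s,s'$ agree on all coordinates in $I\subseteq\{1,\dots,n\}$, their optimizer sets in $D$ are distinct singletons, and the same strict gap condition (gap exceeding $2\delta$) holds at $s$ and at $s'$. Then $I$ is not sufficient in $D'$.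
   Context: A decision problem on $S$ with action set $A$ and utility $U:A\times S\to\mathbb R$ has optimizer map $\mathrm{Opt}(s)=\{a\in A:\ U(a',s)\le U(a,s)\ \forall a'\in A\}$. A set $I$ is sufficient if $s_j=s'_j$ for all $j\in I$ implies $\mathrm{Opt}(s)=\mathrm{Opt}(s')$. A coordinate $i$ is relevant if there exist $s,s'$ agreeing on all coordinates $j\neq i$ with $\mathrm{Opt}(s)\neq\mathrm{Opt}(s')$. -}

module Defs where

open import Level using (Level; suc; _⊔_)
open import Data.Nat using (ℕ)
open import Data.Fin using (Fin)
open import Data.Fin.Subset using (Subset; _∈_)
open import Data.Product using (Σ; ∃; _×_; _,_)
open import Data.Sum using (_⊎_)
open import Relation.Binary.PropositionalEquality using (_≡_; _≢_)
open import Relation.Binary.Structures using (IsStrictTotalOrder)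
open import Relation.Nullary using (¬_)
open import Algebra.Bundles using (CommutativeRing)
open import Function.Bundles using (_⇔_)

-- Real numbers are not available in agda-stdlib.  Utilities take values in an
-- arbitrary totally ordered commutative ring (the reals being an instance).
record OrderedCommRing (c ℓ : Level) : Set (suc (c ⊔ ℓ)) where
  field
    commRing : CommutativeRing c ℓ
  open CommutativeRing commRing public
  field
    _<_ : Carrier → Carrier → Set ℓ
    <-isStrictTotalOrder : IsStrictTotalOrder _≈_ _<_
    +-monoˡ-< : ∀ {x y} z → x < y → (x + z) < (y + z)
    *-pos : ∀ {x y} → 0# < x → 0# < y → 0# < (x * y)
    0<1 : 0# < 1#

  _≤_ : Carrier → Carrier → Set ℓ
  x ≤ y = (x < y) ⊎ (x ≈ y)

module DecisionProblems {c ℓ} (R : OrderedCommRing c ℓ) where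
  open OrderedCommRing R

  State : (n : ℕ) → (Fin n → Set) → Set
  State n X = (i : Fin n) → X i

  Utility : (A : Set) → (n : ℕ) → (Fin n → Set) → Set c
  Utility A n X = A → State n X → Carrier

  Opt : ∀ {A n X} → Utility A n X → State n X → A → Set ℓ
  Opt U s a = ∀ a' → U a' s ≤ U a s

  SameOpt : ∀ {A n X} → Utility A n X → State n X → State n X → Set ℓ
  SameOpt U s s' = ∀ a → Opt U s a ⇔ Opt U s' a

  OptIsSingleton : ∀ {A n X} → Utility A n X → State n X → A → Set ℓ
  OptIsSingleton U s a = ∀ b → Opt U s b ⇔ (b ≡ a)

  AgreeOff : ∀ {n X} → Fin n → State n X → State n X → Set
  AgreeOff i s s' = ∀ j → j ≢ i → s j ≡ s' j

  AgreeOn : ∀ {n X} → Subset n → State n X → State n X → Set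
  AgreeOn I s s' = ∀ j → j ∈ I → s j ≡ s' j

  Relevant : ∀ {A n X} → Utility A n X → Fin n → Set ℓ
  Relevant {n = n} {X} U i =
    Σ (State n X) λ s → Σ (State n X) λ s' → AgreeOff i s s' × ¬ SameOpt U s s'

  Sufficient : ∀ {A n X} → Utility A n X → Subset n → Set ℓ
  Sufficient {n = n} {X} U I =
    ∀ (s s' : State n X) → AgreeOn I s s' → SameOpt U s s'

  Close : ∀ {A n X} → Utility A n X → Utility A n X → Carrier → Set ℓ
  Close U U' δ = ∀ a s → ((U a s - U' a s) ≤ δ) × ((U' a s - U a s) ≤ δ)

  StrictGap : ∀ {A n X} → Utility A n X → State n X → A → Carrier → Set (c ⊔ ℓ)
  StrictGap {A} U t a⋆ δ =
    Σ Carrier λ γ → ((δ + δ) < γ) × (∀ (b : A) → b ≢ a⋆ → γ ≤ (U a⋆ t - U b t))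

{-# OPTIONS --safe #-}
module Submission where

-- A δ-perturbation moves a utility difference by at most 2δ:
-- U'(a⋆,t) - U'(b,t) ≥ (U(a⋆,t) - U(b,t)) - 2δ ≥ γ - 2δ > 0.  So a⋆ is a strict,
-- hence the unique, optimizer of D' at t as well.  As the optimizers at s and s'
-- differ, Opt'(s) ≠ Opt'(s'), and the pair s, s' witnesses both the relevance of i
-- and the insufficiency of I.

open import Defs
open import Level using (Level)
open import Data.Nat using (ℕ)
open import Data.Fin using (Fin)
open import Data.Fin.Subset using (Subset)
open import Data.Product using (_×_; _,_; proj₁; proj₂)
open import Data.Sum using (inj₁; inj₂)
open import Relation.Binary.PropositionalEquality using (_≢_)
import Relation.Binary.PropositionalEquality as ≡
open import Relation.Binary.Bundles using (StrictTotalOrder)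
open import Relation.Binary.Definitions using (tri<; tri≈; tri>)
open import Relation.Nullary using (¬_; contradiction)
open import Function.Bundles using (Equivalence)
open DecisionProblems

module OrderedCommRingProperties {c ℓ : Level} (R : OrderedCommRing c ℓ) where
  open OrderedCommRing R

  strictTotalOrder : StrictTotalOrder c ℓ ℓ
  strictTotalOrder = record { isStrictTotalOrder = <-isStrictTotalOrder }

  open StrictTotalOrder strictTotalOrder public
    using (compare; irrefl; asym)
  open import Relation.Binary.Reasoning.StrictPartialOrder
    (StrictTotalOrder.strictPartialOrder strictTotalOrder)
  open import Algebra.Properties.Group +-group using (//-rightDividesʳ)
  open import Algebra.Properties.CommutativeSemigroup +-commutativeSemigroup
    using (interchange)

  <⇒≱ : ∀ {x y} → x < y → ¬ (y ≤ x)
  <⇒≱ x<y (inj₁ y<x) = asym x<y y<x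
  <⇒≱ x<y (inj₂ y≈x) = irrefl (sym y≈x) x<y

  +-monoˡ-≤ : ∀ {x y} z → x ≤ y → (x + z) ≤ (y + z)
  +-monoˡ-≤ z (inj₁ x<y) = inj₁ (+-monoˡ-< z x<y)
  +-monoˡ-≤ z (inj₂ x≈y) = inj₂ (+-congʳ x≈y)

  +-cancelʳ-< : ∀ {x y} z → (x + z) < (y + z) → x < y
  +-cancelʳ-< {x} {y} z x+z<y+z = begin-strict
    x             ≈⟨ //-rightDividesʳ z x ⟨
    x + z - z     <⟨ +-monoˡ-< (- z) x+z<y+z ⟩
    y + z - z     ≈⟨ //-rightDividesʳ z y ⟩
    y             ∎

  x-y<0⇒x<y : ∀ {x y} → (x - y) < 0# → x < y
  x-y<0⇒x<y {x} {y} x-y<0 = +-cancelʳ-< (- y) (begin-strict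
    x - y         <⟨ x-y<0 ⟩
    0#            ≈⟨ -‿inverseʳ y ⟨
    y - y         ∎)

  x-x′+y′-y≈y′-x′+x-y : ∀ x y x′ y′ → (x - x′) + (y′ - y) ≈ (y′ - x′) + (x - y)
  x-x′+y′-y≈y′-x′+x-y x y x′ y′ = begin-equality
    (x - x′) + (y′ - y)      ≈⟨ interchange x (- x′) y′ (- y) ⟩
    (x + y′) + (- x′ - y)    ≈⟨ +-congʳ (+-comm x y′) ⟩
    (y′ + x) + (- x′ - y)    ≈⟨ interchange y′ (- x′) x (- y) ⟨
    (y′ - x′) + (x - y)      ∎

  δ-perturbation-preserves-< : ∀ {x y x′ y′ δ} →
    (δ + δ) < (x - y) → (x - x′) ≤ δ → (y′ - y) ≤ δ → y′ < x′
  δ-perturbation-preserves-< {x} {y} {x′} {y′} {δ} 2δ<x-y x-x′≤δ y′-y≤δ =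
    x-y<0⇒x<y (+-cancelʳ-< (x - y) (begin-strict
      (y′ - x′) + (x - y)    ≈⟨ x-x′+y′-y≈y′-x′+x-y x y x′ y′ ⟨
      (x - x′) + (y′ - y)    ≤⟨ +-monoˡ-≤ (y′ - y) x-x′≤δ ⟩
      δ + (y′ - y)           ≈⟨ +-comm δ (y′ - y) ⟩
      (y′ - y) + δ           ≤⟨ +-monoˡ-≤ δ y′-y≤δ ⟩
      δ + δ                  <⟨ 2δ<x-y ⟩
      x - y                  ≈⟨ +-identityˡ (x - y) ⟨
      0# + (x - y)           ∎))

module StrictOptimizers {c ℓ : Level} (R : OrderedCommRing c ℓ) where
  open OrderedCommRing R
  open OrderedCommRingProperties R
  open import Relation.Binary.Reasoning.StrictPartialOrder
    (StrictTotalOrder.strictPartialOrder strictTotalOrder)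

  StrictOptimizer : ∀ {A n X} → Utility R A n X → State R n X → A → Set ℓ
  StrictOptimizer U t a = ∀ b → b ≢ a → U b t < U a t

  module _ {A : Set} {n : ℕ} {X : Fin n → Set} where

    -- Equality on A need not be decidable, but b ≢ a follows from U a t < U b t.
    StrictOptimizer⇒Opt : ∀ {U : Utility R A n X} {t a} → StrictOptimizer U t a → Opt R U t a
    StrictOptimizer⇒Opt {U} {t} {a} win b with compare (U b t) (U a t)
    ... | tri< b<a _ _ = inj₁ b<a
    ... | tri≈ _ b≈a _ = inj₂ b≈a
    ... | tri> _ _ a<b = contradiction (win b b≢a) (asym a<b)
      where
      b≢a : b ≢ a
      b≢a ≡.refl = irrefl refl a<b

    StrictOptimizer⇒¬SameOpt : ∀ {U : Utility R A n X} {s s′ a a′} →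
      StrictOptimizer U s a → StrictOptimizer U s′ a′ → a ≢ a′ → ¬ SameOpt R U s s′
    StrictOptimizer⇒¬SameOpt {U} {a = a} {a′} win win′ a≢a′ same =
      <⇒≱ (win′ a a≢a′) (Equivalence.to (same a) (StrictOptimizer⇒Opt {U} win) a′)

    StrictGap⇒StrictOptimizer : ∀ {U U′ : Utility R A n X} {δ t a} →
      Close R U U′ δ → StrictGap R U t a δ → StrictOptimizer U′ t a
    StrictGap⇒StrictOptimizer {U} {U′} {δ} {t} {a} close (γ , 2δ<γ , gap) b b≢a =
      δ-perturbation-preserves-< 2δ<U-gap (proj₁ (close a t)) (proj₂ (close b t))
      where
      2δ<U-gap : (δ + δ) < (U a t - U b t)
      2δ<U-gap = begin-strict
        δ + δ           <⟨ 2δ<γ ⟩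
        γ               ≤⟨ gap b b≢a ⟩
        U a t - U b t   ∎

mainTheorem13 : ∀ {c ℓ : Level} (R : OrderedCommRing c ℓ)
    (n : ℕ) (X : Fin n → Set) (A : Set) (U U' : Utility R A n X)
    (δ : OrderedCommRing.Carrier R)
    → Close R U U' δ
    → (∀ (i : Fin n) (s s' : State R n X) (a a' : A)
         → AgreeOff R i s s'
         → OptIsSingleton R U s a → OptIsSingleton R U s' a' → a ≢ a'
         → StrictGap R U s a δ → StrictGap R U s' a' δ
         → Relevant R U' i)
      × (∀ (I : Subset n) (s s' : State R n X) (a a' : A)
         → AgreeOn R I s s'
         → OptIsSingleton R U s a → OptIsSingleton R U s' a' → a ≢ a'
         → StrictGap R U s a δ → StrictGap R U s' a' δ
         → ¬ Sufficient R U' I)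
mainTheorem13 R n X A U U′ δ close =
    (λ i s s′ a a′ agree _ _ a≢a′ gap gap′ → s , s′ , agree , optimizersDiffer gap gap′ a≢a′)
  , (λ I s s′ a a′ agree _ _ a≢a′ gap gap′ sufficient →
       optimizersDiffer gap gap′ a≢a′ (sufficient s s′ agree))
  where
  open StrictOptimizers R

  optimizersDiffer : ∀ {s s′ a a′} → StrictGap R U s a δ → StrictGap R U s′ a′ δ →
    a ≢ a′ → ¬ SameOpt R U′ s s′
  optimizersDiffer gap gap′ =
    StrictOptimizer⇒¬SameOpt {U = U′} (StrictGap⇒StrictOptimizer close gap)
      (StrictGap⇒StrictOptimizer close gap′)
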